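{- Let $U$ be an it-complete and it-tame set of time-constructible bounds. Then every subset $B\subseteq U$ which is closed under $\le_{\mathrm{it}}$ within $U$ and contains some $\beta_0$ with $2n\le_a\beta_0(n)$ is regular.
   Context: A (time) bound is $\beta:\mathbb{N}\to\mathbb{N}$ with $n\le\beta(n)\le\beta(n+1)$. $f\le_a g$: $f(n)\le g(n)$ for almost all $n$; for sets, $B_1\le_a B_2$: each element of $B_1$ is $\le_a$ some element of $B_2$. $\mathrm{It}(\beta)=\{\beta^{\langle m\rangle}:m\ge1\}$ ($m$-fold iterates). $\beta_1\le_{\mathrm{it}}\beta_2$ iff $\mathrm{It}(\beta_1)\le_a\mathrm{It}(\beta_2)$. $B\subseteq U$ is closed under $\le_{\mathrm{it}}$ if $\beta\in U$ and $\beta\le_{\mathrm{it}}\beta'$ for some $\beta'\in B$ imply $\beta\in B$. $U$ is it-tame if any two elements are $\le_{\mathrm{it}}$-comparable; it-complete if for every $\beta\in U$ there is $B\subseteq U$ with $B\le_a\mathrm{It}(\beta)$ and $\mathrm{It}(\beta)\le_a B$. Time-constructible: $w\mapsto1^{\beta(|w|)}$ computable by a deterministic multitape TM with output tape in time $O(\beta(|w|))$. A nonempty $B$ is regular if (i) every $\beta\in B$ has a time-constructible $\beta'\in B$ with $\beta\le_a\beta'$, and (ii) for all $\beta,\beta'\in B$ some $\beta''\in B$ satisfies $\beta+\beta'\circ\beta\le_a\beta''$. -}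

module Defs where

open import Data.Nat using (ℕ; zero; suc; _+_; _*_; _≤_)
open import Data.Product using (Σ; ∃; _×_; _,_)
open import Data.Sum using (_⊎_)
open import Relation.Binary.PropositionalEquality using (_≡_)

record Bound : Set where
  constructor mkBound
  field
    fn   : ℕ → ℕ
    ext  : ∀ n → n ≤ fn n
    mono : ∀ n → fn n ≤ fn (suc n)
open Bound public

_≤ₐ_ : (ℕ → ℕ) → (ℕ → ℕ) → Set
f ≤ₐ g = Σ ℕ λ N → ∀ n → N ≤ n → f n ≤ g n

-- k-fold composition; the m-fold iterate β^⟨m⟩ (m ≥ 1) is  iter (suc k) β  with m = suc k.
iter : ℕ → (ℕ → ℕ) → ℕ → ℕ
iter zero    f n = n
iter (suc k) f n = f (iter k f n)

It : Bound → (ℕ → ℕ) → Set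
It β g = Σ ℕ λ k → ∀ n → g n ≡ iter (suc k) (fn β) n

BoundSet : Set₁
BoundSet = Bound → Set

_≤ₐˢ_ : ((ℕ → ℕ) → Set) → ((ℕ → ℕ) → Set) → Set
B₁ ≤ₐˢ B₂ = ∀ f → B₁ f → Σ (ℕ → ℕ) λ g → B₂ g × f ≤ₐ g

fns : BoundSet → (ℕ → ℕ) → Set
fns B f = Σ Bound λ β → B β × (∀ n → f n ≡ fn β n)

_≤it_ : Bound → Bound → Set
β₁ ≤it β₂ = It β₁ ≤ₐˢ It β₂

_⊆_ : BoundSet → BoundSet → Set
B ⊆ U = ∀ β → B β → U β

ClosedIt : BoundSet → BoundSet → Set
ClosedIt U B = ∀ β β' → U β → B β' → β ≤it β' → B β

ItTame : BoundSet → Set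
ItTame U = ∀ β β' → U β → U β' → (β ≤it β') ⊎ (β' ≤it β)

ItComplete : BoundSet → Set₁
ItComplete U = ∀ β → U β →
  Σ BoundSet λ B → (B ⊆ U) × (fns B ≤ₐˢ It β) × (It β ≤ₐˢ fns B)

-- Regularity, relative to a notion TC of time-constructibility of functions.
Regular : ((ℕ → ℕ) → Set) → BoundSet → Set
Regular TC B =
  (Σ Bound λ β → B β)
  × (∀ β → B β → Σ Bound λ β' → B β' × TC (fn β') × (fn β ≤ₐ fn β'))
  × (∀ β β' → B β → B β' →
       Σ Bound λ β'' → B β'' × ((λ n → fn β n + fn β' (fn β n)) ≤ₐ fn β''))

-- Tameness yields, inside B, a single γ that it-dominates β, β' and β₀, so each of them lies
-- almost everywhere below an iterate of γ.  As β is inflationary and 2n ≤ₐ β₀, this gives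
-- β + β' ∘ β ≤ₐ 2·γ^⟨a+b⟩ ≤ₐ β₀ ∘ γ^⟨a+b⟩ ≤ₐ γ^⟨m⟩.  Completeness of U at γ supplies β'' ∈ U with
-- γ^⟨m⟩ ≤ₐ β'' ≤ₐ γ^⟨j⟩; the second bound makes β'' ≤it γ, so β'' ∈ B by closure.  Condition (i)
-- of regularity holds with β' = β, since every bound in U is time-constructible.
module Submission where

open import Defs
open import Data.Nat using (ℕ; zero; suc; _+_; _*_; _≤_; _≤′_; ≤′-refl; ≤′-step)
open import Data.Nat.Properties
  using (≤-refl; ≤-reflexive; ≤-trans; ≤⇒≤′; m+n≤o⇒m≤o; m+n≤o⇒n≤o; +-mono-≤; +-identityʳ)
open import Data.Product using (Σ; _×_; _,_)
open import Data.Sum using (inj₁; inj₂)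
open import Function using (_∘_)
open import Relation.Binary.Core using (_Preserves_⟶_)
open import Relation.Binary.Bundles using (Setoid)
open import Relation.Binary.Structures using (IsPreorder)
open import Relation.Binary.PropositionalEquality
  using (_≗_; refl; sym; cong; _→-setoid_; module ≡-Reasoning)
import Relation.Binary.Reasoning.Base.Double as PreorderReasoning

Inflationary : (ℕ → ℕ) → Set
Inflationary f = ∀ n → n ≤ f n

fn-mono : (β : Bound) → fn β Preserves _≤_ ⟶ _≤_
fn-mono β x≤y = go (≤⇒≤′ x≤y)
  where
  go : ∀ {x y} → x ≤′ y → fn β x ≤ fn β y
  go ≤′-refl        = ≤-refl
  go (≤′-step x≤′y) = ≤-trans (go x≤′y) (mono β _)

iter-mono : ∀ {f} → f Preserves _≤_ ⟶ _≤_ → ∀ k → iter k f Preserves _≤_ ⟶ _≤_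
iter-mono f-mono zero    x≤y = x≤y
iter-mono f-mono (suc k) x≤y = f-mono (iter-mono f-mono k x≤y)

iter-inflationary : ∀ {f} → Inflationary f → ∀ k → Inflationary (iter k f)
iter-inflationary f-infl zero    n = ≤-refl
iter-inflationary f-infl (suc k) n = ≤-trans (iter-inflationary f-infl k n) (f-infl _)

iter-+ : ∀ a b f → iter (a + b) f ≗ iter a f ∘ iter b f
iter-+ zero    b f n = refl
iter-+ (suc a) b f n = cong f (iter-+ a b f n)

iter-* : ∀ m k f → iter m (iter k f) ≗ iter (m * k) f
iter-* zero    k f n = refl
iter-* (suc m) k f n = begin
  iter k f (iter m (iter k f) n) ≡⟨ cong (iter k f) (iter-* m k f n) ⟩
  iter k f (iter (m * k) f n)    ≡⟨ sym (iter-+ k (m * k) f n) ⟩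
  iter (k + m * k) f n           ∎
  where open ≡-Reasoning

≤ₐ-reflexive : ∀ {f g} → f ≗ g → f ≤ₐ g
≤ₐ-reflexive f≗g = 0 , λ n _ → ≤-reflexive (f≗g n)

≤ₐ-trans : ∀ {f g h} → f ≤ₐ g → g ≤ₐ h → f ≤ₐ h
≤ₐ-trans (M , f≤g) (N , g≤h) =
  M + N , λ n M+N≤n → ≤-trans (f≤g n (m+n≤o⇒m≤o M M+N≤n)) (g≤h n (m+n≤o⇒n≤o M M+N≤n))

≤ₐ-isPreorder : IsPreorder _≗_ _≤ₐ_
≤ₐ-isPreorder = record
  { isEquivalence = Setoid.isEquivalence (ℕ →-setoid ℕ)
  ; reflexive     = ≤ₐ-reflexive
  ; trans         = ≤ₐ-trans
  }

module ≤ₐ-Reasoning = PreorderReasoning ≤ₐ-isPreorder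

≤ₐ-+ : ∀ {f₁ f₂ g₁ g₂} → f₁ ≤ₐ g₁ → f₂ ≤ₐ g₂ →
       (λ n → f₁ n + f₂ n) ≤ₐ (λ n → g₁ n + g₂ n)
≤ₐ-+ (M , f₁≤g₁) (N , f₂≤g₂) =
  M + N , λ n M+N≤n → +-mono-≤ (f₁≤g₁ n (m+n≤o⇒m≤o M M+N≤n)) (f₂≤g₂ n (m+n≤o⇒n≤o M M+N≤n))

∘-mono-≤ₐ : ∀ {f₁ f₂ g₁ g₂} → Inflationary f₁ → g₂ Preserves _≤_ ⟶ _≤_ →
            f₁ ≤ₐ g₁ → f₂ ≤ₐ g₂ → (f₂ ∘ f₁) ≤ₐ (g₂ ∘ g₁)
∘-mono-≤ₐ {f₁} f₁-infl g₂-mono (M , f₁≤g₁) (N , f₂≤g₂) =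
  M + N , λ n M+N≤n →
    ≤-trans (f₂≤g₂ (f₁ n) (≤-trans (m+n≤o⇒n≤o M M+N≤n) (f₁-infl n)))
            (g₂-mono (f₁≤g₁ n (m+n≤o⇒m≤o M M+N≤n)))

iter-mono-≤ₐ : ∀ {f g} → Inflationary f → g Preserves _≤_ ⟶ _≤_ →
               f ≤ₐ g → ∀ m → iter m f ≤ₐ iter m g
iter-mono-≤ₐ f-infl g-mono f≤g zero    = ≤ₐ-reflexive (λ _ → refl)
iter-mono-≤ₐ f-infl g-mono f≤g (suc m) =
  ∘-mono-≤ₐ (iter-inflationary f-infl m) g-mono (iter-mono-≤ₐ f-infl g-mono f≤g m) f≤g

≤ₐˢ-trans : ∀ {B₁ B₂ B₃} → B₁ ≤ₐˢ B₂ → B₂ ≤ₐˢ B₃ → B₁ ≤ₐˢ B₃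
≤ₐˢ-trans B₁≤B₂ B₂≤B₃ f f∈B₁ with B₁≤B₂ f f∈B₁
... | g , g∈B₂ , f≤g with B₂≤B₃ g g∈B₂
... | h , h∈B₃ , g≤h = h , h∈B₃ , ≤ₐ-trans f≤g g≤h

≤it-refl : ∀ β → β ≤it β
≤it-refl β f f∈Itβ = f , f∈Itβ , ≤ₐ-reflexive (λ _ → refl)

≤it-trans : ∀ {β β' β''} → β ≤it β' → β' ≤it β'' → β ≤it β''
≤it-trans = ≤ₐˢ-trans

≤it⇒≤ₐ-iter : ∀ {β γ} → β ≤it γ → Σ ℕ λ k → fn β ≤ₐ iter (suc k) (fn γ)
≤it⇒≤ₐ-iter {β} β≤γ with β≤γ (fn β) (0 , λ _ → refl)
... | g , (k , g≗γᵏ) , β≤g = k , ≤ₐ-trans β≤g (≤ₐ-reflexive g≗γᵏ)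

≤ₐ-iter⇒≤it : ∀ {β γ} k → fn β ≤ₐ iter (suc k) (fn γ) → β ≤it γ
≤ₐ-iter⇒≤it {β} {γ} k β≤γᵏ f (m , f≗βᵐ) =
  iter (suc m * suc k) (fn γ) , (k + m * suc k , λ _ → refl) , f≤γᵐᵏ
  where
  open ≤ₐ-Reasoning
  f≤γᵐᵏ : f ≤ₐ iter (suc m * suc k) (fn γ)
  f≤γᵐᵏ = begin
    f                                ≈⟨ f≗βᵐ ⟩
    iter (suc m) (fn β)              ≲⟨ iter-mono-≤ₐ (ext β) (iter-mono (fn-mono γ) (suc k))
                                                     β≤γᵏ (suc m) ⟩
    iter (suc m) (iter (suc k) (fn γ)) ≈⟨ iter-* (suc m) (suc k) (fn γ) ⟩
    iter (suc m * suc k) (fn γ)      ∎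

+∘-≤ₐ-iter : ∀ (γ : Bound) {f f'} a b d → Inflationary f →
             f ≤ₐ iter a (fn γ) → f' ≤ₐ iter b (fn γ) → (λ n → 2 * n) ≤ₐ iter d (fn γ) →
             (λ n → f n + f' (f n)) ≤ₐ iter (d + (b + a)) (fn γ)
+∘-≤ₐ-iter γ {f} {f'} a b d f-infl f≤γᵃ f'≤γᵇ 2n≤γᵈ = begin
  (λ n → f n + f' (f n))  ≲⟨ ≤ₐ-+ f≤H f'∘f≤H ⟩
  (λ n → H n + H n)       ≈⟨ (λ n → cong (H n +_) (sym (+-identityʳ (H n)))) ⟩
  (λ n → 2 * n) ∘ H       ≲⟨ ∘-mono-≤ₐ (iter-inflationary (ext γ) (b + a))
                                        (iter-mono (fn-mono γ) d) (≤ₐ-reflexive (λ _ → refl)) 2n≤γᵈ ⟩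
  iter d (fn γ) ∘ H       ≈⟨ (λ n → sym (iter-+ d (b + a) (fn γ) n)) ⟩
  iter (d + (b + a)) (fn γ) ∎
  where
  open ≤ₐ-Reasoning
  H = iter (b + a) (fn γ)
  f'∘f≤H : (f' ∘ f) ≤ₐ H
  f'∘f≤H = begin
    f' ∘ f                        ≲⟨ ∘-mono-≤ₐ f-infl (iter-mono (fn-mono γ) b) f≤γᵃ f'≤γᵇ ⟩
    iter b (fn γ) ∘ iter a (fn γ) ≈⟨ (λ n → sym (iter-+ b a (fn γ) n)) ⟩
    H                             ∎
  f≤H : f ≤ₐ H
  f≤H = begin
    f                             ≲⟨ f≤γᵃ ⟩
    iter a (fn γ)                 ≲⟨ 0 , (λ n _ → iter-inflationary (ext γ) b (iter a (fn γ) n)) ⟩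
    iter b (fn γ) ∘ iter a (fn γ) ≈⟨ (λ n → sym (iter-+ b a (fn γ) n)) ⟩
    H                             ∎

module _ {U B : BoundSet} (B⊆U : B ⊆ U) where

  ≤it-upper-bound : ItTame U → ∀ {β β'} → B β → B β' →
                    Σ Bound λ γ → B γ × β ≤it γ × β' ≤it γ
  ≤it-upper-bound tame {β} {β'} β∈B β'∈B with tame β β' (B⊆U β β∈B) (B⊆U β' β'∈B)
  ... | inj₁ β≤β' = β' , β'∈B , β≤β' , ≤it-refl β'
  ... | inj₂ β'≤β = β , β∈B , ≤it-refl β , β'≤β

  iter-≤ₐ-member : ItComplete U → ClosedIt U B → ∀ {γ} → B γ → ∀ k →
                   Σ Bound λ β'' → B β'' × iter (suc k) (fn γ) ≤ₐ fn β''
  iter-≤ₐ-member complete closed {γ} γ∈B k with complete γ (B⊆U γ γ∈B)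
  ... | C , C⊆U , C≤Itγ , Itγ≤C with Itγ≤C (iter (suc k) (fn γ)) (k , λ _ → refl)
  ... | g , (β'' , β''∈C , g≗β'') , γᵏ≤g with C≤Itγ (fn β'') (β'' , β''∈C , λ _ → refl)
  ... | h , (j , h≗γʲ) , β''≤h =
    β'' , closed β'' γ (C⊆U β'' β''∈C) γ∈B β''≤γ , ≤ₐ-trans γᵏ≤g (≤ₐ-reflexive g≗β'')
    where
    β''≤γ : β'' ≤it γ
    β''≤γ = ≤ₐ-iter⇒≤it {β''} {γ} j (≤ₐ-trans β''≤h (≤ₐ-reflexive h≗γʲ))

  +∘-≤ₐ-member : ItTame U → ItComplete U → ClosedIt U B →
                 ∀ {β₀ β β'} → B β₀ → (λ n → 2 * n) ≤ₐ fn β₀ → B β → B β' →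
                 Σ Bound λ β'' → B β'' × (λ n → fn β n + fn β' (fn β n)) ≤ₐ fn β''
  +∘-≤ₐ-member tame complete closed {β₀} {β} {β'} β₀∈B 2n≤β₀ β∈B β'∈B
    with ≤it-upper-bound tame β∈B β'∈B
  ... | γ₁ , γ₁∈B , β≤γ₁ , β'≤γ₁ with ≤it-upper-bound tame γ₁∈B β₀∈B
  ... | γ , γ∈B , γ₁≤γ , β₀≤γ
    with ≤it⇒≤ₐ-iter {β} {γ} (≤it-trans {β} {γ₁} {γ} β≤γ₁ γ₁≤γ)
       | ≤it⇒≤ₐ-iter {β'} {γ} (≤it-trans {β'} {γ₁} {γ} β'≤γ₁ γ₁≤γ)
       | ≤it⇒≤ₐ-iter {β₀} {γ} β₀≤γ
  ... | a , β≤γᵃ | b , β'≤γᵇ | d , β₀≤γᵈ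
    with iter-≤ₐ-member complete closed γ∈B (d + (suc b + suc a))
  ... | β'' , β''∈B , γᵐ≤β'' =
    β'' , β''∈B ,
    ≤ₐ-trans (+∘-≤ₐ-iter γ {fn β} {fn β'} (suc a) (suc b) (suc d) (ext β) β≤γᵃ β'≤γᵇ
                         (≤ₐ-trans 2n≤β₀ β₀≤γᵈ))
             γᵐ≤β''

lemma22 : (TimeConstructible : (ℕ → ℕ) → Set)
          (U : BoundSet) → (∀ β → U β → TimeConstructible (fn β))
          → ItComplete U → ItTame U
          → (B : BoundSet) → B ⊆ U → ClosedIt U B
          → (β₀ : Bound) → B β₀ → (λ n → 2 * n) ≤ₐ fn β₀
          → Regular TimeConstructible B
lemma22 _ _ U-tc complete tame B B⊆U closed β₀ β₀∈B 2n≤β₀ =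
  (β₀ , β₀∈B) ,
  (λ β β∈B → β , β∈B , U-tc β (B⊆U β β∈B) , ≤ₐ-reflexive (λ _ → refl)) ,
  (λ β β' β∈B β'∈B → +∘-≤ₐ-member B⊆U tame complete closed β₀∈B 2n≤β₀ β∈B β'∈B)
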